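{- Let $3\le m\le n$ and let $c$ be an exact $(m+n+1)$-coloring of $[m]\times[n]$ with no rainbow solution to $x_1+x_2=x_3$. Then $|c(D_m)|\ge 3$.
   Context: $[m]\times[n]=\{(i,j)\in\mathbb{Z}^2:1\le i\le m,1\le j\le n\}$ with componentwise addition. An $r$-coloring is a map $c:[m]\times[n]\to\{1,\dots,r\}$, exact if surjective; a rainbow solution is a triple $\alpha,\beta,\gamma$ with $\alpha+\beta=\gamma$ and pairwise distinct colors. $D_m=\{(i,i):1\le i\le m\}$ is the main diagonal and $c(X)=\{c(x):x\in X\}$. -}

module Defs where

open import Data.Nat using (ℕ; suc; _+_)
open import Data.Fin using (Fin; toℕ)
open import Data.Product using (_×_; _,_; Σ; ∃; ∃-syntax)
open import Relation.Binary.PropositionalEquality using (_≡_; _≢_)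

-- The grid [m]×[n]: a point is a pair (i , j) with i : Fin m, j : Fin n,
-- representing the integer point (toℕ i + 1 , toℕ j + 1) ∈ [m]×[n].
Grid : ℕ → ℕ → Set
Grid m n = Fin m × Fin n

coord₁ : ∀ {m n} → Grid m n → ℕ
coord₁ (i , _) = suc (toℕ i)

coord₂ : ∀ {m n} → Grid m n → ℕ
coord₂ (_ , j) = suc (toℕ j)

SumEq : ∀ {m n} → Grid m n → Grid m n → Grid m n → Set
SumEq α β γ = (coord₁ α + coord₁ β ≡ coord₁ γ) × (coord₂ α + coord₂ β ≡ coord₂ γ)

Coloring : ℕ → ℕ → ℕ → Set
Coloring m n r = Grid m n → Fin r

Exact : ∀ {m n r} → Coloring m n r → Set
Exact {m} {n} {r} c = (k : Fin r) → ∃[ x ] c x ≡ k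

RainbowSolution : ∀ {m n r} → Coloring m n r → Set
RainbowSolution {m} {n} c =
  ∃[ α ] ∃[ β ] ∃[ γ ] (SumEq α β γ × c α ≢ c β × c α ≢ c γ × c β ≢ c γ)

DiagColors≥3 : ∀ {m n r} → Coloring m n r → Set
DiagColors≥3 {m} {n} c =
  ∃[ x ] ∃[ y ] ∃[ z ]
    ( (coord₁ x ≡ coord₂ x) × (coord₁ y ≡ coord₂ y) × (coord₁ z ≡ coord₂ z)
    × c x ≢ c y × c x ≢ c z × c y ≢ c z )

{-# OPTIONS --safe #-}

-- Fix a diagonal point o. Send the colour of o to 0 and every other colour k to 1 plus the
-- index of the line parallel to the diagonal through a point of colour k, chosen on the
-- diagonal whenever k occurs there. There are m + n − 1 such lines, so m + n + 1 colours
-- force two colours k ≠ k', both different from c o, onto one line through points p, q.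
-- If p is diagonal, so is q, and o, p, q have three colours. Otherwise neither k nor k'
-- occurs on the diagonal; but the lower of p, q plus the diagonal point q − p (or p − q)
-- gives the other, a rainbow solution.
module Submission where

open import Defs
open import Data.Nat using (ℕ; suc; _≤_; _<_; _+_; z<s)
open import Data.Nat.Properties
  using (+-comm; +-suc; +-mono-≤; +-cancelˡ-≡; +-cancelʳ-≡; m<m+n; <-trans;
         m∸n+n≡m; m≤n⇒∃[o]m+o≡n; <-cmp; suc-injective; module ≤-Reasoning)
  renaming (_≟_ to _≟ℕ_)
open import Data.Nat.Tactic.RingSolver using (solve-∀)
open import Data.Fin using (Fin; toℕ; fromℕ<; opposite; zero)
open import Data.Fin.Properties
  using (toℕ<n; toℕ-fromℕ<; fromℕ<-injective; toℕ-injective; opposite-prop; any?; pigeonhole; <⇒≢; _≟_)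
open import Data.Product using (_×_; _,_; proj₁; proj₂; Σ-syntax; ∃-syntax)
open import Data.Empty using (⊥-elim)
open import Function using (_∘_; const)
open import Relation.Nullary using (¬_; Dec; yes; no)
open import Relation.Nullary.Decidable using (_×-dec_)
open import Relation.Binary.PropositionalEquality
  using (_≡_; _≢_; refl; sym; trans; cong; cong₂; subst; subst₂; ≢-sym; module ≡-Reasoning)
open import Relation.Binary.Definitions using (tri<; tri≈; tri>)

private
  variable
    m n r : ℕ

Diagonal : Grid m n → Set
Diagonal x = coord₁ x ≡ coord₂ x

-- j₁ − i₁ ≡ j₂ − i₂, moved around so that no subtraction occurs.
SameDiagonal : Grid m n → Grid m n → Set
SameDiagonal (i₁ , j₁) (i₂ , j₂) = toℕ j₁ + toℕ i₂ ≡ toℕ j₂ + toℕ i₁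

SameDiagonal-preserves-Diagonal : (p q : Grid m n) → SameDiagonal p q → Diagonal p → Diagonal q
SameDiagonal-preserves-Diagonal (i₁ , j₁) (i₂ , j₂) same diag =
  cong suc (+-cancelˡ-≡ (toℕ i₁) _ _ (begin
    toℕ i₁ + toℕ i₂  ≡⟨ cong (_+ toℕ i₂) (suc-injective diag) ⟩
    toℕ j₁ + toℕ i₂  ≡⟨ same ⟩
    toℕ j₂ + toℕ i₁  ≡⟨ +-comm (toℕ j₂) (toℕ i₁) ⟩
    toℕ i₁ + toℕ j₂  ∎))
  where open ≡-Reasoning

SameDiagonal-sameRow⇒≡ : (p q : Grid m n) → SameDiagonal p q → toℕ (proj₁ p) ≡ toℕ (proj₁ q) → p ≡ q
SameDiagonal-sameRow⇒≡ (i₁ , j₁) (i₂ , j₂) same row =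
  cong₂ _,_ (toℕ-injective row)
            (toℕ-injective (+-cancelʳ-≡ (toℕ i₂) _ _ (trans same (cong (toℕ j₂ +_) row))))

SameDiagonal⇒diagonalDifference : (p q : Grid m n) → SameDiagonal p q → toℕ (proj₁ p) < toℕ (proj₁ q) →
                                  ∃[ α ] (Diagonal α × SumEq α p q)
SameDiagonal⇒diagonalDifference {m} {n} (i₁ , j₁) (i₂ , j₂) same i₁<i₂ =
    (fromℕ< k<m , fromℕ< k<n)
  , cong suc (trans (toℕ-fromℕ< k<m) (sym (toℕ-fromℕ< k<n)))
  , cong suc (trans (cong (_+ suc (toℕ i₁)) (toℕ-fromℕ< k<m)) rows)
  , cong suc (trans (cong (_+ suc (toℕ j₁)) (toℕ-fromℕ< k<n)) columns)
  where
  k : ℕ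
  k = proj₁ (m≤n⇒∃[o]m+o≡n i₁<i₂)

  rows : k + suc (toℕ i₁) ≡ toℕ i₂
  rows = trans (+-comm k (suc (toℕ i₁))) (proj₂ (m≤n⇒∃[o]m+o≡n i₁<i₂))

  columns : k + suc (toℕ j₁) ≡ toℕ j₂
  columns = +-cancelʳ-≡ (toℕ i₁) _ _ (begin
    k + suc (toℕ j₁) + toℕ i₁    ≡⟨ shuffle k (toℕ j₁) (toℕ i₁) ⟩
    toℕ j₁ + (k + suc (toℕ i₁))  ≡⟨ cong (toℕ j₁ +_) rows ⟩
    toℕ j₁ + toℕ i₂              ≡⟨ same ⟩
    toℕ j₂ + toℕ i₁              ∎)
    where
    open ≡-Reasoning
    shuffle : ∀ k b a → k + suc b + a ≡ b + (k + suc a)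
    shuffle = solve-∀

  below : ∀ {a b N} → k + suc a ≡ b → b < N → k < N
  below eq b<N = <-trans (subst (k <_) eq (m<m+n k z<s)) b<N

  k<m : k < m
  k<m = below rows (toℕ<n i₂)

  k<n : k < n
  k<n = below columns (toℕ<n j₂)

-- Indexes the m + n − 1 lines parallel to the diagonal: 0 is the line through (m , 1).
diagonalOffset : Grid m n → ℕ
diagonalOffset (i , j) = toℕ j + toℕ (opposite i)

toℕ-opposite+suc : (i : Fin m) → toℕ (opposite i) + suc (toℕ i) ≡ m
toℕ-opposite+suc i = trans (cong (_+ suc (toℕ i)) (opposite-prop i)) (m∸n+n≡m (toℕ<n i))

suc-diagonalOffset< : (x : Grid m n) → suc (diagonalOffset x) < m + n
suc-diagonalOffset< {m} {n} (i , j) = begin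
  suc (suc (toℕ j + toℕ (opposite i)))  ≡⟨ cong suc (+-suc (toℕ j) (toℕ (opposite i))) ⟨
  suc (toℕ j) + suc (toℕ (opposite i))  ≤⟨ +-mono-≤ (toℕ<n j) (toℕ<n (opposite i)) ⟩
  n + m                                 ≡⟨ +-comm n m ⟩
  m + n                                 ∎
  where open ≤-Reasoning

diagonalOffset-≡⇒SameDiagonal : (p q : Grid m n) → diagonalOffset p ≡ diagonalOffset q → SameDiagonal p q
diagonalOffset-≡⇒SameDiagonal {m} (i₁ , j₁) (i₂ , j₂) eq = +-cancelʳ-≡ m _ _ (begin
  (b₁ + a₂) + m                ≡⟨ cong ((b₁ + a₂) +_) (toℕ-opposite+suc i₁) ⟨
  (b₁ + a₂) + (o₁ + suc a₁)    ≡⟨ regroup b₁ a₂ o₁ a₁ ⟩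
  (b₁ + o₁) + suc (a₂ + a₁)    ≡⟨ cong₂ _+_ eq (cong suc (+-comm a₂ a₁)) ⟩
  (b₂ + o₂) + suc (a₁ + a₂)    ≡⟨ regroup b₂ a₁ o₂ a₂ ⟨
  (b₂ + a₁) + (o₂ + suc a₂)    ≡⟨ cong ((b₂ + a₁) +_) (toℕ-opposite+suc i₂) ⟩
  (b₂ + a₁) + m                ∎)
  where
  open ≡-Reasoning
  a₁ = toℕ i₁
  a₂ = toℕ i₂
  b₁ = toℕ j₁
  b₂ = toℕ j₂
  o₁ = toℕ (opposite i₁)
  o₂ = toℕ (opposite i₂)

  regroup : ∀ b a' o a → (b + a') + (o + suc a) ≡ (b + o) + suc (a' + a)
  regroup = solve-∀

module _ (c : Coloring m n r) where

  HasDiagonalPoint : Fin r → Set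
  HasDiagonalPoint k = ∃[ x ] (Diagonal x × c x ≡ k)

  hasDiagonalPoint? : (k : Fin r) → Dec (HasDiagonalPoint k)
  hasDiagonalPoint? k
    with any? (λ i → any? (λ j → (suc (toℕ i) ≟ℕ suc (toℕ j)) ×-dec (c (i , j) ≟ k)))
  ... | yes (i , j , diag , col) = yes ((i , j) , diag , col)
  ... | no none = no λ { ((i , j) , diag , col) → none (i , j , diag , col) }

  rainbow-fromDiagonalDifference : ∀ {α p q} → Diagonal α → SumEq α p q → c p ≢ c q →
                                   ¬ HasDiagonalPoint (c p) → ¬ HasDiagonalPoint (c q) → RainbowSolution c
  rainbow-fromDiagonalDifference {α} {p} {q} diag sum p≢q noDiagP noDiagQ =
    α , p , q , sum , (λ eq → noDiagP (α , diag , eq)) , (λ eq → noDiagQ (α , diag , eq)) , p≢q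

  rainbow-fromSameDiagonal : (p q : Grid m n) → SameDiagonal p q → c p ≢ c q →
                             ¬ HasDiagonalPoint (c p) → ¬ HasDiagonalPoint (c q) → RainbowSolution c
  rainbow-fromSameDiagonal p q same p≢q noDiagP noDiagQ
    with <-cmp (toℕ (proj₁ p)) (toℕ (proj₁ q))
  ... | tri< p<q _ _ =
    let α , diag , sum = SameDiagonal⇒diagonalDifference p q same p<q
    in rainbow-fromDiagonalDifference diag sum p≢q noDiagP noDiagQ
  ... | tri≈ _ row _ = ⊥-elim (p≢q (cong c (SameDiagonal-sameRow⇒≡ p q same row)))
  ... | tri> _ _ q<p =
    let α , diag , sum = SameDiagonal⇒diagonalDifference q p (sym same) q<p
    in rainbow-fromDiagonalDifference diag sum (≢-sym p≢q) noDiagQ noDiagP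

  Representative : Grid m n → Set
  Representative x = HasDiagonalPoint (c x) → Diagonal x

  representative : Exact c → (k : Fin r) → Σ[ x ∈ Grid m n ] (c x ≡ k × Representative x)
  representative exact k with hasDiagonalPoint? k
  ... | yes (x , diag , col) = x , col , const diag
  ... | no none = proj₁ (exact k) , proj₂ (exact k) ,
                  λ has → ⊥-elim (none (subst HasDiagonalPoint (proj₂ (exact k)) has))

  DiagColors≥3-fromSameDiagonal : ¬ RainbowSolution c → (o p q : Grid m n) → Diagonal o →
                                  SameDiagonal p q → Representative p → Representative q →
                                  c p ≢ c q → c p ≢ c o → c q ≢ c o → DiagColors≥3 c
  DiagColors≥3-fromSameDiagonal noRainbow o p q diagO same repP repQ p≢q p≢o q≢o
    with coord₁ p ≟ℕ coord₂ p
  ... | yes diagP =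
    p , q , o , diagP , SameDiagonal-preserves-Diagonal p q same diagP , diagO , p≢q , p≢o , q≢o
  ... | no offP = ⊥-elim (noRainbow (rainbow-fromSameDiagonal p q same p≢q (offP ∘ repP) (offQ ∘ repQ)))
    where
    offQ : ¬ Diagonal q
    offQ = offP ∘ SameDiagonal-preserves-Diagonal q p (sym same)

  module _ (exact : Exact c) (o : Grid m n) where
    private
      point : Fin r → Grid m n
      point k = proj₁ (representative exact k)

      point-colour : (k : Fin r) → c (point k) ≡ k
      point-colour k = proj₁ (proj₂ (representative exact k))

      isRepresentative : (k : Fin r) → Representative (point k)
      isRepresentative k = proj₂ (proj₂ (representative exact k))

      colour-≢ : (k k' : Fin r) → k ≢ k' → c (point k) ≢ k'
      colour-≢ k k' = subst (_≢ k') (sym (point-colour k))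

      slot : Fin r → ℕ
      slot k with k ≟ c o
      ... | yes _ = 0
      ... | no _ = suc (diagonalOffset (point k))

      slot< : (k : Fin r) → slot k < m + n
      slot< k with k ≟ c o
      ... | yes _ = <-trans z<s (suc-diagonalOffset< o)
      ... | no _ = suc-diagonalOffset< (point k)

      slot-collision : (k k' : Fin r) → k ≢ k' → slot k ≡ slot k' →
                       k ≢ c o × k' ≢ c o × diagonalOffset (point k) ≡ diagonalOffset (point k')
      slot-collision k k' k≢k' eq with k ≟ c o | k' ≟ c o
      ... | yes k≡o | yes k'≡o = ⊥-elim (k≢k' (trans k≡o (sym k'≡o)))
      ... | no k≢o | no k'≢o = k≢o , k'≢o , suc-injective eq
      slot-collision _ _ _ () | yes _ | no _
      slot-collision _ _ _ () | no _ | yes _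

    DiagColors≥3-ifManyColours : m + n < r → ¬ RainbowSolution c → Diagonal o → DiagColors≥3 c
    DiagColors≥3-ifManyColours m+n<r noRainbow diagO
      with i , j , i<j , sameSlot ← pigeonhole m+n<r (λ k → fromℕ< (slot< k))
      with i≢o , j≢o , sameOffset ← slot-collision i j (<⇒≢ i<j)
                                      (fromℕ<-injective _ _ (slot< i) (slot< j) sameSlot) =
      DiagColors≥3-fromSameDiagonal noRainbow o (point i) (point j) diagO
        (diagonalOffset-≡⇒SameDiagonal (point i) (point j) sameOffset)
        (isRepresentative i) (isRepresentative j)
        (subst₂ _≢_ (sym (point-colour i)) (sym (point-colour j)) (<⇒≢ i<j))
        (colour-≢ i (c o) i≢o) (colour-≢ j (c o) j≢o)

corollary2p9 : (m n : ℕ) → 3 ≤ m → m ≤ n → (c : Coloring m n (m + n + 1)) →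
    Exact c → ¬ RainbowSolution c → DiagColors≥3 c
corollary2p9 (suc m) (suc n) _ _ c exact noRainbow =
  DiagColors≥3-ifManyColours c exact (zero , zero) (m<m+n (suc m + suc n) z<s) noRainbow refl
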